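{- Let $\Sigma=\{a_1,\ldots,a_k\}$ and $\Sigma'=\{b_1,\ldots,b_m\}$ be alphabets and let $D$ and $D'$ be decoders over $\Sigma$ and $\Sigma'$ respectively. Suppose a graph $G$ on $n$ vertices has a letter realisation $(\ell,c)$ over $D$, and let $w=w(\ell,c)=w_1\cdots w_n$. Suppose $w$ has a factor $w_jw_{j+1}\cdots w_{j+p}$ such that (1) exactly $t$ pairwise distinct letters $a_{s_1},\ldots,a_{s_t}$ occur in it, and (2) there is a set of positions $J\subseteq I:=\{j,j+1,\ldots,j+p\}$ such that reading the letters $w_i$, $i\in J$, in increasing order of $i$ gives the word $(a_{s_1}a_{s_2}\cdots a_{s_t})^{2^{t-1}+1}$ (the concatenation of $2^{t-1}+1$ copies of $a_{s_1}\cdots a_{s_t}$). Let $B:=\{x\in V(G): c(x)\in J\}$ (blue vertices) and $R:=\{x\in V(G): c(x)\in I\setminus J\}$ (red vertices), and let $G':=G\setminus R$. If $G'$ has a letter realisation $(\ell',c')$ over $D'$ such that any two blue vertices $x,y\in B$ with $\ell(x)=\ell(y)$ satisfy $\ell'(x)=\ell'(y)$, then $G$ has a letter realisation $(\ell'',c'')$ over $D'$.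
   Context: A decoder is a directed graph $D=(\Sigma,A)$ (loops allowed) on a finite alphabet $\Sigma$. An $n$-vertex graph $G=(V,E)$ has letter realisation $(\ell,c)$ over $D$, where $\ell:V\to\Sigma$ and $c:V\to[n]$ is a bijection, if two distinct vertices $x,y$ are adjacent iff either $(\ell(x),\ell(y))\in A$ and $c(x)<c(y)$, or $(\ell(y),\ell(x))\in A$ and $c(y)<c(x)$. The word of the realisation is $w(\ell,c)=w_1\cdots w_n$ with $w_i=\ell(c^{ -1}(i))$. A factor of a word is a contiguous subword. -}

module Defs where

open import Data.Nat as ℕ using (ℕ; zero; suc; _+_; _≤ᵇ_)
open import Data.Fin as Fin using (Fin; toℕ)
open import Data.Fin.Subset using (Subset)
open import Data.Vec using (Vec; []; _∷_; lookup)
open import Data.Bool using (Bool; true; false; T; not; _∧_)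
open import Data.List using (List; []; _∷_)
open import Data.Product using (Σ; _×_; _,_; proj₁)
open import Data.Sum using (_⊎_)
open import Relation.Nullary using (¬_)
open import Relation.Binary.PropositionalEquality using (_≡_; _≢_)
open import Function.Bundles using (_↔_; _⇔_; Inverse)

record Graph (n : ℕ) : Set₁ where
  field
    Adj    : Fin n → Fin n → Set
    sym    : ∀ {x y} → Adj x y → Adj y x
    irrefl : ∀ {x} → ¬ Adj x x

-- A decoder over the alphabet Σ = Fin k: a digraph (loops allowed),
-- given by its (decidable) arc relation A.
Decoder : ℕ → Set
Decoder k = Fin k → Fin k → Bool

-- (ℓ , c) is a letter realisation over D of the graph with vertex type V and
-- adjacency Adj, where c : V ↔ Fin m is a bijection (positions 0..m-1,
-- i.e. [m] shifted by one, which does not affect the order).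
IsLetterRealisation : {V : Set} {k m : ℕ} (Adj : V → V → Set) (D : Decoder k)
                      (ℓ : V → Fin k) (c : V ↔ Fin m) → Set
IsLetterRealisation Adj D ℓ c =
  ∀ x y → x ≢ y →
    Adj x y ⇔ ((T (D (ℓ x) (ℓ y)) × Inverse.to c x Fin.< Inverse.to c y)
              ⊎ (T (D (ℓ y) (ℓ x)) × Inverse.to c y Fin.< Inverse.to c x))

word : {n k : ℕ} (ℓ : Fin n → Fin k) (c : Fin n ↔ Fin n) → Fin n → Fin k
word ℓ c i = ℓ (Inverse.from c i)

read : {A : Set} {n : ℕ} → Subset n → (Fin n → A) → List A
read {n = zero}  []          f = []
read {n = suc n} (true ∷ J)  f = f Fin.zero ∷ read J (λ i → f (Fin.suc i))
read {n = suc n} (false ∷ J) f = read J (λ i → f (Fin.suc i))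

inI : {n : ℕ} (j p : ℕ) → Fin n → Bool
inI j p i = (j ≤ᵇ toℕ i) ∧ (toℕ i ≤ᵇ j + p)

isBlue : {n : ℕ} (c : Fin n ↔ Fin n) (J : Subset n) → Fin n → Bool
isBlue c J x = lookup J (Inverse.to c x)

isRed : {n : ℕ} (c : Fin n ↔ Fin n) (j p : ℕ) (J : Subset n) → Fin n → Bool
isRed c j p J x = inI j p (Inverse.to c x) ∧ not (lookup J (Inverse.to c x))

VDel : {n : ℕ} (c : Fin n ↔ Fin n) (j p : ℕ) (J : Subset n) → Set
VDel c j p J = Σ (Fin _) (λ x → T (not (isRed c j p J x)))

AdjDel : {n : ℕ} (G : Graph n) (c : Fin n ↔ Fin n) (j p : ℕ) (J : Subset n) →
         VDel c j p J → VDel c j p J → Set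
AdjDel G c j p J x y = Graph.Adj G (proj₁ x) (proj₁ y)

{-# OPTIONS --safe #-}
module Submission where

-- Inside the factor the blue vertices read (s₁⋯s_t)^r with r = 2^(t-1)+1, so the graph they induce is
-- realised twice: over D with the copies in factor order, and over D' by the realisation of G', in which
-- all copies of s_q carry one letter B q. Compare the two on the copies of a pair of letters. If D has
-- exactly one of the two arcs between them, the realisation over D' interleaves their copies, keeping or
-- reversing their order; otherwise D' agrees with D on the pair, or puts all copies of one letter before
-- all copies of the other. Following such one-way pairs from a representative letter (at most t-1 steps),
-- copy t-1 of the representative stays between two copies of every letter reached, since r > 2(t-1); its
-- position in G' is the anchor of the component. Each vertex of the factor, red or blue, labelled s_q now
-- gets the letter B q and is placed at the anchor of q, vertices at one anchor keeping their order in G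
-- (reversed if the component is reversed); vertices outside the factor keep their positions in G'.
-- Sorting these keys gives the realisation of G over D'.

open import Level using (Level)
open import Data.Bool as Bool using (Bool; true; false; T; not; _xor_)
open import Data.Bool.Properties using (¬-not; xor-same; T-∧; ∧-zeroʳ)
open import Data.Empty using (⊥-elim)
open import Data.Fin as Fin using (Fin; Fin′; toℕ; fromℕ<; inject)
import Data.Fin.Properties as Fin
open import Data.Fin.Subset using (Subset; _∈_; _∉_; _⊂_; ∣_∣; ⊤; ⁅_⁆; _∪_)
open import Data.Fin.Subset.Properties
  using (p⊂q⇒∣p∣<∣q∣; ⊆⊤; ∈⊤; ∣⊤∣≡n; ∣p∣≤n; ∣p∣≡n⇒p≡⊤; ∣⁅x⁆∣≡1; _∈?_; x∈⁅x⁆; x∈⁅y⁆⇒x≡y; p⊆p∪q; q⊆p∪q; x∈p∪q⁻)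
open import Data.Integer as ℤ using (ℤ; +_; -_)
import Data.Integer.Properties as ℤ
open import Data.List using (List; []; _∷_; map; length; _++_; concat; replicate; tabulate)
open import Data.List.Properties using (length-++; length-map; length-tabulate)
open import Data.Nat as ℕ using (ℕ; zero; suc; _+_; _*_; _∸_; _^_; _<_; _≤_; z≤n; s≤s)
import Data.Nat.Properties as ℕ
open import Data.Product using (Σ; ∃; ∃₂; _×_; _,_; proj₁; proj₂)
open import Data.Product.Relation.Binary.Lex.Strict using (×-strictTotalOrder)
open import Data.Product.Relation.Binary.Pointwise.NonDependent using (Pointwise; ≡×≡⇒≡)
open import Data.Sum as Sum using (_⊎_; inj₁; inj₂; [_,_]′)
open import Data.Unit using (tt)
open import Data.Vec as Vec using ([]; _∷_; here; there)
open import Data.Vec.Properties using (lookup∘tabulate; lookup⇒[]=; []=⇒lookup)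
open import Function using (_∘_; id)
open import Function.Bundles using (_⇔_; _↔_; mk⇔; mk⤖; Inverse; Equivalence; Injection)
open import Function.Construct.Composition using () renaming (equivalence to ⇔-trans)
open import Function.Construct.Symmetry using (⇔-sym)
open import Function.Definitions using (Injective)
open import Function.Properties.Bijection using (⤖⇒↔)
open import Function.Properties.Inverse using (↔⇒↣)
open import Function.Related.Propositional using (module EquationalReasoning)
open import Relation.Binary using (Rel; StrictTotalOrder; Trichotomous; tri<; tri≈; tri>)
open import Relation.Binary.PropositionalEquality hiding ([_])
open import Relation.Nullary using (¬_; Dec; yes; no; does; proof; contradiction; Reflects; invert)
open import Relation.Nullary.Decidable using (_×-dec_; T?; ¬?; decidable-stable; dec-true; dec-false)
open import Relation.Unary using (Pred; Decidable)

open import Defs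

private variable
  a b ℓ ℓ₁ ℓ₂ : Level
  X Y : Set

open Equivalence

-- The adjacency rule of a letter realisation, for vertices at positions x and y whose letters a and b have
-- u = D a b and v = D b a.
data Oriented {A : Set a} (_<_ : Rel A ℓ) (u v : Bool) (x y : A) : Set ℓ where
  forward  : T u → x < y → Oriented _<_ u v x y
  backward : T v → y < x → Oriented _<_ u v x y

module _ {A : Set a} {B : Set b} {_<₁_ : Rel A ℓ₁} {_<₂_ : Rel B ℓ₂} {u v : Bool} where

  Oriented-cong : ∀ {x y x' y'} → x <₁ y ⇔ x' <₂ y' → y <₁ x ⇔ y' <₂ x' →
                  Oriented _<₁_ u v x y ⇔ Oriented _<₂_ u v x' y'
  Oriented-cong xy yx = mk⇔ (λ { (forward u p) → forward u (to xy p) ; (backward v p) → backward v (to yx p) })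
                            (λ { (forward u p) → forward u (from xy p) ; (backward v p) → backward v (from yx p) })

module _ {A : Set a} {_<_ : Rel A ℓ} where

  Oriented⇔⊎ : ∀ {u v x y} → Oriented _<_ u v x y ⇔ ((T u × x < y) ⊎ (T v × y < x))
  Oriented⇔⊎ = mk⇔ (λ { (forward u p) → inj₁ (u , p) ; (backward v p) → inj₂ (v , p) })
                   (λ { (inj₁ (u , p)) → forward u p ; (inj₂ (v , p)) → backward v p })

  Oriented-swap : ∀ {u v x y} → Oriented _<_ u v x y ⇔ Oriented _<_ v u y x
  Oriented-swap = mk⇔ swap swap
    where
    swap : ∀ {u v x y} → Oriented _<_ u v x y → Oriented _<_ v u y x
    swap (forward u p) = backward u p
    swap (backward v p) = forward v p

  Oriented-true-false : ∀ {x y} → Oriented _<_ true false x y ⇔ x < y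
  Oriented-true-false = mk⇔ (λ { (forward _ p) → p ; (backward () _) }) (forward _)

  Oriented-symmetric : ∀ {u x y} → x < y ⊎ y < x → Oriented _<_ u u x y ⇔ T u
  Oriented-symmetric x≶y = mk⇔ (λ { (forward u _) → u ; (backward u _) → u })
                               (λ u → [ forward u , backward u ]′ x≶y)

≢⇒≶ : ∀ {A : Set a} {_<_ : Rel A ℓ} → Trichotomous _≡_ _<_ → ∀ {x y} → x ≢ y → x < y ⊎ y < x
≢⇒≶ compare {x} {y} x≢y with compare x y
... | tri< x<y _ _ = inj₁ x<y
... | tri≈ _ x≡y _ = contradiction x≡y x≢y
... | tri> _ _ y<x = inj₂ y<x

realisation-adjacency : ∀ {V : Set} {k m} {Adj : V → V → Set} {D : Decoder k} {ℓ : V → Fin k} {c : V ↔ Fin m} →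
  IsLetterRealisation Adj D ℓ c → ∀ {x y} → x ≢ y →
  Adj x y ⇔ Oriented ℕ._<_ (D (ℓ x) (ℓ y)) (D (ℓ y) (ℓ x)) (toℕ (Inverse.to c x)) (toℕ (Inverse.to c y))
realisation-adjacency R x≢y = ⇔-trans (R _ _ x≢y) (⇔-sym Oriented⇔⊎)

⇔-both : ∀ {A B : Set} → A → B → A ⇔ B
⇔-both a b = mk⇔ (λ _ → b) (λ _ → a)

⇔-neither : ∀ {A B : Set} → ¬ A → ¬ B → A ⇔ B
⇔-neither ¬a ¬b = mk⇔ (⊥-elim ∘ ¬a) (⊥-elim ∘ ¬b)

Oriented-between : ∀ {u v z lo a hi} → lo ≤ a → a ≤ hi → z ≢ a →
  Oriented _<_ u v z lo ⇔ Oriented _<_ u v z hi → Oriented _<_ u v z a ⇔ Oriented _<_ u v z hi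
Oriented-between lo≤a a≤hi z≢a lo⇔hi with ≢⇒≶ ℕ.<-cmp z≢a
... | inj₁ z<a = Oriented-cong (⇔-both z<a z<hi) (⇔-neither (ℕ.<-asym z<a) (ℕ.<-asym z<hi))
  where z<hi = ℕ.<-≤-trans z<a a≤hi
... | inj₂ a<z = ⇔-trans (Oriented-cong (⇔-neither (ℕ.<-asym a<z) (ℕ.<-asym lo<z)) (⇔-both a<z lo<z)) lo⇔hi
  where lo<z = ℕ.≤-<-trans lo≤a a<z

-- Sorting by an injective key

select : ∀ {n p} {P : Pred (Fin n) p} → Decidable P → Subset n
select P? = Vec.tabulate (does ∘ P?)

∈-select : ∀ {n p} {P : Pred (Fin n) p} (P? : Decidable P) {x} → x ∈ select P? ⇔ P x
∈-select P? {x} = mk⇔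
  (λ x∈ → invert (subst (Reflects _) (trans (sym (lookup∘tabulate _ x)) ([]=⇒lookup x∈)) (proof (P? x))))
  (λ px → lookup⇒[]= x _ (trans (lookup∘tabulate _ x) (dec-true (P? x) px)))

injective⇒surjective : ∀ {n} {f : Fin n → Fin n} → Injective _≡_ _≡_ f → ∀ y → ∃ λ x → f x ≡ y
injective⇒surjective {zero} inj ()
injective⇒surjective {suc n} {f} inj y with Fin.any? (λ x → f x Fin.≟ y)
... | yes hit = hit
... | no miss = contradiction (Fin.injective⇒≤ punched-injective) ℕ.1+n≰n
  where
  y≢f : ∀ x → y ≢ f x
  y≢f x y≡fx = miss (x , sym y≡fx)
  punched-injective : Injective _≡_ _≡_ (λ x → Fin.punchOut (y≢f x))
  punched-injective = inj ∘ Fin.punchOut-injective (y≢f _) (y≢f _)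

module Sorting {c ℓ₁ ℓ₂} (O : StrictTotalOrder c ℓ₁ ℓ₂) where

  open StrictTotalOrder O
    using (_≈_; _<?_; compare; irrefl; module Eq) renaming (Carrier to Key; _<_ to _≺_; trans to ≺-trans)

  module _ {n} (key : Fin n → Key) (key-injective : ∀ {x y} → key x ≈ key y → x ≡ y) where

    below : Fin n → Subset n
    below x = select λ z → key z <? key x

    ∈-below : ∀ {x z} → z ∈ below x ⇔ key z ≺ key x
    ∈-below {x} = ∈-select (λ z → key z <? key x)

    ∉-below-self : ∀ x → x ∉ below x
    ∉-below-self x = irrefl Eq.refl ∘ to ∈-below

    below-⊂ : ∀ {x y} → key x ≺ key y → below x ⊂ below y
    below-⊂ {x} {y} x≺y =
      (λ z∈ → from ∈-below (≺-trans (to ∈-below z∈) x≺y)) , x , from ∈-below x≺y , ∉-below-self x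

    ∣below∣<n : ∀ x → ∣ below x ∣ < n
    ∣below∣<n x = ℕ.<-≤-trans (p⊂q⇒∣p∣<∣q∣ (⊆⊤ , x , ∈⊤ , ∉-below-self x)) (ℕ.≤-reflexive (∣⊤∣≡n n))

    rank : Fin n → Fin n
    rank x = fromℕ< (∣below∣<n x)

    rank-mono : ∀ {x y} → key x ≺ key y → rank x Fin.< rank y
    rank-mono {x} {y} x≺y =
      subst₂ _<_ (sym (Fin.toℕ-fromℕ< (∣below∣<n x))) (sym (Fin.toℕ-fromℕ< (∣below∣<n y)))
                 (p⊂q⇒∣p∣<∣q∣ (below-⊂ x≺y))

    rank-≺ : ∀ x y → rank x Fin.< rank y ⇔ key x ≺ key y
    rank-≺ x y = mk⇔ reflects rank-mono
      where
      reflects : rank x Fin.< rank y → key x ≺ key y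
      reflects rx<ry with compare (key x) (key y)
      ... | tri< kx<ky _ _ = kx<ky
      ... | tri≈ _ kx≈ky _ = contradiction rx<ry (ℕ.<-irrefl (cong (toℕ ∘ rank) (key-injective kx≈ky)))
      ... | tri> _ _ ky<kx = contradiction rx<ry (ℕ.<-asym (rank-mono ky<kx))

    rank-injective : Injective _≡_ _≡_ rank
    rank-injective {x} {y} rx≡ry with compare (key x) (key y)
    ... | tri< kx<ky _ _ = contradiction (cong toℕ rx≡ry) (ℕ.<⇒≢ (rank-mono kx<ky))
    ... | tri≈ _ kx≈ky _ = key-injective kx≈ky
    ... | tri> _ _ ky<kx = contradiction (cong toℕ rx≡ry) (ℕ.>⇒≢ (rank-mono ky<kx))

    sortBy : Fin n ↔ Fin n
    sortBy = ⤖⇒↔ (mk⤖ (rank-injective , surjective))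
      where
      surjective : ∀ y → ∃ λ x → ∀ {z} → z ≡ x → rank z ≡ y
      surjective y = let (x , rx≡y) = injective⇒surjective rank-injective y in x , λ { refl → rx≡y }

    realisation-by-key : ∀ {m} {Adj : Fin n → Fin n → Set} {D : Decoder m} {ℓ : Fin n → Fin m} →
      (∀ x y → x ≢ y → Adj x y ⇔ Oriented _≺_ (D (ℓ x) (ℓ y)) (D (ℓ y) (ℓ x)) (key x) (key y)) →
      IsLetterRealisation Adj D ℓ sortBy
    realisation-by-key adj x y x≢y =
      ⇔-trans (adj x y x≢y)
              (⇔-trans (Oriented-cong (⇔-sym (rank-≺ x y)) (⇔-sym (rank-≺ y x))) (Oriented⇔⊎ {_<_ = Fin._<_}))

-- Bounded reachability in a graph on Fin t

module Components {t : ℕ} (E : Fin t → Fin t → Bool) (E-sym : ∀ {q q'} → T (E q q') → T (E q' q)) where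

  infixl 5 _▸_
  data Walk (q₀ : Fin t) : Fin t → ℕ → Set where
    []  : Walk q₀ q₀ 0
    _▸_ : ∀ {q q' k} → Walk q₀ q k → T (E q q') → Walk q₀ q' (suc k)

  Neighbour : Subset t → Fin t → Set
  Neighbour S q = ∃ λ q' → q' ∈ S × T (E q' q)

  neighbours : Subset t → Subset t
  neighbours S = select λ q → Fin.any? λ q' → q' ∈? S ×-dec T? (E q' q)

  ∈-neighbours : ∀ {S q} → q ∈ neighbours S ⇔ Neighbour S q
  ∈-neighbours {S} = ∈-select λ q → Fin.any? λ q' → q' ∈? S ×-dec T? (E q' q)

  reach : ℕ → Fin t → Subset t
  reach zero    q₀ = ⁅ q₀ ⁆
  reach (suc k) q₀ = reach k q₀ ∪ neighbours (reach k q₀)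

  Closed : Subset t → Set
  Closed S = ∀ {q q'} → q ∈ S → T (E q q') → q' ∈ S

  reach-refl : ∀ k q → q ∈ reach k q
  reach-refl zero    q = x∈⁅x⁆ q
  reach-refl (suc k) q = p⊆p∪q _ (reach-refl k q)

  reach-step : ∀ {k q₀ q q'} → q ∈ reach k q₀ → T (E q q') → q' ∈ reach (suc k) q₀
  reach-step {k} {q₀} q∈ e = q⊆p∪q (reach k q₀) _ (from ∈-neighbours (_ , q∈ , e))

  reach-suc⁻ : ∀ {k q₀ q} → q ∈ reach (suc k) q₀ → q ∈ reach k q₀ ⊎ Neighbour (reach k q₀) q
  reach-suc⁻ {k} {q₀} q∈ = Sum.map₂ (to ∈-neighbours) (x∈p∪q⁻ (reach k q₀) _ q∈)

  reach⇒walk : ∀ {k q₀ q} → q ∈ reach k q₀ → ∃ λ k' → k' ≤ k × Walk q₀ q k'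
  reach⇒walk {zero} {q₀} q∈ with x∈⁅y⁆⇒x≡y q₀ q∈
  ... | refl = 0 , z≤n , []
  reach⇒walk {suc k} {q₀} q∈ with reach-suc⁻ {k} q∈
  ... | inj₁ q∈′ = let (k' , k'≤k , w) = reach⇒walk {k} {q₀} q∈′ in k' , ℕ.m≤n⇒m≤1+n k'≤k , w
  ... | inj₂ (q' , q'∈ , e) = let (k' , k'≤k , w) = reach⇒walk {k} {q₀} q'∈ in suc k' , s≤s k'≤k , w ▸ e

  reach-closed-suc : ∀ {k q₀} → Closed (reach k q₀) → Closed (reach (suc k) q₀)
  reach-closed-suc {k} {q₀} closed q∈ e = p⊆p∪q _ (closed (shrink q∈) e)
    where
    shrink : ∀ {q} → q ∈ reach (suc k) q₀ → q ∈ reach k q₀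
    shrink q∈ with reach-suc⁻ {k} q∈
    ... | inj₁ q∈′ = q∈′
    ... | inj₂ (q' , q'∈ , e') = closed q'∈ e'

  Escape : Subset t → Set
  Escape S = ∃ λ q → ∃ λ q' → q ∈ S × T (E q q') × q' ∉ S

  escape? : ∀ S → Dec (Escape S)
  escape? S = Fin.any? λ q → Fin.any? λ q' → q ∈? S ×-dec T? (E q q') ×-dec ¬? (q' ∈? S)

  no-escape⇒closed : ∀ {S} → ¬ Escape S → Closed S
  no-escape⇒closed {S} none {q} {q'} q∈ e with q' ∈? S
  ... | yes q'∈ = q'∈
  ... | no q'∉ = contradiction (q , q' , q∈ , e , q'∉) none

  closed-or-growing : ∀ k q₀ → Closed (reach k q₀) ⊎ suc k ≤ ∣ reach k q₀ ∣
  closed-or-growing zero q₀ = inj₂ (ℕ.≤-reflexive (sym (∣⁅x⁆∣≡1 q₀)))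
  closed-or-growing (suc k) q₀ with closed-or-growing k q₀ | escape? (reach k q₀)
  ... | inj₁ closed | _ = inj₁ (reach-closed-suc {k} {q₀} closed)
  ... | inj₂ _ | no none = inj₁ (reach-closed-suc {k} {q₀} (no-escape⇒closed none))
  ... | inj₂ large | yes (q , q' , q∈ , e , q'∉) =
    inj₂ (ℕ.≤-trans (s≤s large) (p⊂q⇒∣p∣<∣q∣ (p⊆p∪q _ , q' , reach-step {k} {q₀} q∈ e , q'∉)))

  reach-closed : ∀ {k} → t ≤ suc k → ∀ q₀ → Closed (reach k q₀)
  reach-closed {k} t≤1+k q₀ with closed-or-growing k q₀
  ... | inj₁ closed = closed
  ... | inj₂ large = subst Closed (sym full) (λ _ _ → ∈⊤)
    where full = ∣p∣≡n⇒p≡⊤ (ℕ.≤-antisym (∣p∣≤n (reach k q₀)) (ℕ.≤-trans t≤1+k large))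

  module Representative (K : ℕ) (t≤1+K : t ≤ suc K) where

    private
      smallest : ∀ q → ∃ λ q₀ → ¬ q ∉ reach K q₀ × ((j : Fin′ q₀) → q ∉ reach K (inject j))
      smallest q = Fin.¬∀⟶∃¬-smallest t _ (λ q₀ → ¬? (q ∈? reach K q₀)) (λ none → none q (reach-refl K q))

    rep : Fin t → Fin t
    rep q = proj₁ (smallest q)

    rep-reaches : ∀ q → q ∈ reach K (rep q)
    rep-reaches q = decidable-stable (q ∈? reach K (rep q)) (proj₁ (proj₂ (smallest q)))

    rep-least : ∀ {q q₀} → q₀ Fin.< rep q → q ∉ reach K q₀
    rep-least {q} q₀<rep = subst (λ q₀ → q ∉ reach K q₀) inject-j≡q₀ (proj₂ (proj₂ (smallest q)) j)
      where
      j = fromℕ< q₀<rep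
      inject-j≡q₀ = Fin.toℕ-injective (trans (Fin.toℕ-inject j) (Fin.toℕ-fromℕ< q₀<rep))

    rep-edge : ∀ {q q'} → T (E q q') → rep q ≡ rep q'
    rep-edge {q} {q'} e with Fin.<-cmp (rep q) (rep q')
    ... | tri≈ _ same _ = same
    ... | tri< lt _ _ = contradiction (reach-closed t≤1+K (rep q) (rep-reaches q) e) (rep-least lt)
    ... | tri> _ _ gt = contradiction (reach-closed t≤1+K (rep q') (rep-reaches q') (E-sym e)) (rep-least gt)

    rep-walk : ∀ q → ∃ λ k → k ≤ K × Walk (rep q) q k
    rep-walk q = reach⇒walk (rep-reaches q)

-- Orientation-normalised positions

orient : Bool → ℕ → ℤ
orient true  x = + x
orient false x = - (+ x)

orient-injective : ∀ d {x y} → orient d x ≡ orient d y → x ≡ y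
orient-injective true  = ℤ.+-injective
orient-injective false = ℤ.+-injective ∘ ℤ.neg-injective

orient-< : ∀ d {x y} → orient d x ℤ.< orient d y ⇔ Oriented ℕ._<_ d (not d) x y
orient-< true  = mk⇔ (forward _ ∘ ℤ.drop‿+<+)
                     λ { (forward _ x<y) → ℤ.+<+ x<y ; (backward () _) }
orient-< false = mk⇔ (backward _ ∘ ℤ.drop‿+<+ ∘ ℤ.neg-cancel-<)
                     λ { (forward () _) ; (backward _ y<x) → ℤ.neg-mono-< (ℤ.+<+ y<x) }

orient-forward : ∀ d {x y} → Oriented ℤ._<_ d (not d) (orient d x) (orient d y) ⇔ x < y
orient-forward true  = mk⇔ (λ { (forward _ x<y) → ℤ.drop‿+<+ x<y ; (backward () _) })
                           (forward _ ∘ ℤ.+<+)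
orient-forward false = mk⇔ (λ { (forward () _) ; (backward _ y<x) → ℤ.drop‿+<+ (ℤ.neg-cancel-< y<x) })
                           (backward _ ∘ ℤ.neg-mono-< ∘ ℤ.+<+)

orient-between : ∀ d {x y z} → orient d x ℤ.≤ orient d y → orient d y ℤ.≤ orient d z →
                 (x ≤ y × y ≤ z) ⊎ (z ≤ y × y ≤ x)
orient-between true  x≤y y≤z = inj₁ (ℤ.drop‿+≤+ x≤y , ℤ.drop‿+≤+ y≤z)
orient-between false x≤y y≤z = inj₂ (ℤ.drop‿+≤+ (ℤ.neg-cancel-≤ y≤z) , ℤ.drop‿+≤+ (ℤ.neg-cancel-≤ x≤y))

orient-<? : ∀ d {x y} → orient d x ℤ.< orient d y → does (x ℕ.<? y) ≡ d
orient-<? true  p = dec-true (_ ℕ.<? _) (ℤ.drop‿+<+ p)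
orient-<? false p = dec-false (_ ℕ.<? _) (ℕ.<-asym (ℤ.drop‿+<+ (ℤ.neg-cancel-< p)))

keyOrder : StrictTotalOrder _ _ _
keyOrder = ×-strictTotalOrder ℕ.<-strictTotalOrder ℤ.<-strictTotalOrder

open StrictTotalOrder keyOrder public using () renaming (_<_ to _<ₖ_)

<ₖ-first : ∀ {a a' i i'} → a ≢ a' → (a , i) <ₖ (a' , i') ⇔ a < a'
<ₖ-first a≢a' = mk⇔ [ id , (λ (a≡a' , _) → contradiction a≡a' a≢a') ]′ inj₁

<ₖ-second : ∀ {a a' i i'} → a ≡ a' → (a , i) <ₖ (a' , i') ⇔ i ℤ.< i'
<ₖ-second refl = mk⇔ [ (λ a<a → contradiction a<a (ℕ.<-irrefl refl)) , proj₂ ]′ (λ i<i' → inj₂ (refl , i<i'))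

idx : ∀ {t} → Fin t → ℕ → ℕ
idx {t} q i = i * t + toℕ q

idx-< : ∀ {t} (q : Fin t) {i r} → i < r → idx q i < r * t
idx-< {t} q {i} {r} i<r = begin-strict
  i * t + toℕ q   <⟨ ℕ.+-monoʳ-< (i * t) (Fin.toℕ<n q) ⟩
  i * t + t       ≡⟨ ℕ.+-comm (i * t) t ⟩
  suc i * t       ≤⟨ ℕ.*-monoˡ-≤ t i<r ⟩
  r * t           ∎
  where open ℕ.≤-Reasoning

idx-monoˡ : ∀ {t} (q q' : Fin t) {i i'} → i < i' → idx q i < idx q' i'
idx-monoˡ {t} q q' {i} {i'} i<i' = ℕ.<-≤-trans (idx-< q i<i') (ℕ.m≤m+n (i' * t) (toℕ q'))

idx-monoʳ : ∀ {t} {q q' : Fin t} i → q Fin.< q' → idx q i < idx q' i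
idx-monoʳ {t} i = ℕ.+-monoʳ-< (i * t)

idx-injective : ∀ {t} {q q' : Fin t} {i i'} → idx q i ≡ idx q' i' → (q , i) ≡ (q' , i')
idx-injective {t} {q} {q'} {i} {i'} eq with ℕ.<-cmp i i'
... | tri< i<i' _ _ = contradiction eq (ℕ.<⇒≢ (idx-monoˡ q q' i<i'))
... | tri> _ _ i'<i = contradiction eq (ℕ.>⇒≢ (idx-monoˡ q' q i'<i))
... | tri≈ _ refl _ = cong (_, i) (Fin.toℕ-injective (ℕ.+-cancelˡ-≡ (i * t) _ _ eq))

directed-irrefl : ∀ {u x} → ¬ Oriented _<_ u (not u) x x
directed-irrefl {u} = ℤ.<-irrefl refl ∘ from (orient-< u)

directed-asym : ∀ {u x y} → Oriented _<_ u (not u) x y → ¬ Oriented _<_ u (not u) y x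
directed-asym {u} x→y y→x = ℤ.<-asym (from (orient-< u) x→y) (from (orient-< u) y→x)

directed-flip : ∀ {u x y} → x ≢ y → ¬ Oriented _<_ u (not u) x y → Oriented _<_ u (not u) y x
directed-flip {u} x≢y ¬x→y =
  [ (λ x<y → contradiction (to (orient-< u) x<y) ¬x→y) , to (orient-< u) ]′ (≢⇒≶ ℤ.<-cmp (x≢y ∘ orient-injective u))

xor-cases : ∀ u v → T (u xor v) → (u ≡ true × v ≡ false) ⊎ (u ≡ false × v ≡ true)
xor-cases true  false _ = inj₁ (refl , refl)
xor-cases false true  _ = inj₂ (refl , refl)

-- Copy i < r of letter q sits at index idx q i of the word (s₁⋯s_t)^r and at position cp q i in the
-- second realisation.
module Copies {t m : ℕ} (K r : ℕ) (t≤1+K : t ≤ suc K) (K+K<r : K + K < r) (1<r : 1 < r)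
  (Dq : Decoder t) (D' : Decoder m) (B : Fin t → Fin m) (cp : Fin t → ℕ → ℕ)
  (cp-injective : ∀ {q q' i i'} → i < r → i' < r → cp q i ≡ cp q' i' → (q , i) ≡ (q' , i'))
  (transfer : ∀ {q q' i i'} → i < r → i' < r → (q , i) ≢ (q' , i') →
    Oriented _<_ (Dq q q') (Dq q' q) (idx q i) (idx q' i') ⇔
    Oriented _<_ (D' (B q) (B q')) (D' (B q') (B q)) (cp q i) (cp q' i'))
  where

  private
    0<1 : 0 < 1
    0<1 = s≤s z≤n

    0<r : 0 < r
    0<r = ℕ.<-trans 0<1 1<r

    K<r : K < r
    K<r = ℕ.≤-<-trans (ℕ.m≤m+n K K) K+K<r

    distinct : ∀ {q q' : Fin t} {i i' : ℕ} → q ≢ q' → (q , i) ≢ (q' , i')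
    distinct q≢q' = q≢q' ∘ cong proj₁

    cp-≢ : ∀ {q q' : Fin t} {i i'} → i < r → i' < r → (q , i) ≢ (q' , i') → cp q i ≢ cp q' i'
    cp-≢ ir ir' ne = ne ∘ cp-injective ir ir'

    cp-≶ : ∀ {q q' : Fin t} {i i'} → i < r → i' < r → (q , i) ≢ (q' , i') →
           cp q i < cp q' i' ⊎ cp q' i' < cp q i
    cp-≶ ir ir' ne = ≢⇒≶ ℕ.<-cmp (cp-≢ ir ir' ne)

    idx-≶ : ∀ {q q' : Fin t} {i i'} → (q , i) ≢ (q' , i') → idx q i < idx q' i' ⊎ idx q' i' < idx q i
    idx-≶ ne = ≢⇒≶ ℕ.<-cmp (ne ∘ idx-injective)

  loops-agree : ∀ q → T (Dq q q) ⇔ T (D' (B q) (B q))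
  loops-agree q = ⇔-trans (⇔-sym (Oriented-symmetric (idx-≶ 0≢1)))
                          (⇔-trans (transfer 0<r 1<r 0≢1) (Oriented-symmetric (cp-≶ 0<r 1<r 0≢1)))
    where
    0≢1 : (q , 0) ≢ (q , 1)
    0≢1 ()

  Transfers : Bool → Fin t → Fin t → Set
  Transfers d q q' = ∀ {x y} → x ≢ y →
    Oriented _<_ (Dq q q') (Dq q' q) x y ⇔ Oriented ℤ._<_ (D' (B q) (B q')) (D' (B q') (B q)) (orient d x) (orient d y)

  transfers-symmetric : ∀ {d q q'} → Dq q' q ≡ Dq q q' → D' (B q') (B q) ≡ D' (B q) (B q') →
                        T (Dq q q') ⇔ T (D' (B q) (B q')) → Transfers d q q'
  transfers-symmetric {d} Dq-sym D'-sym same {x} {y} x≢y rewrite Dq-sym | D'-sym =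
    ⇔-trans (Oriented-symmetric (≢⇒≶ ℕ.<-cmp x≢y))
            (⇔-trans same (⇔-sym (Oriented-symmetric (≢⇒≶ ℤ.<-cmp (x≢y ∘ orient-injective d)))))

  transfers-swap : ∀ {d q q'} → Transfers d q' q → Transfers d q q'
  transfers-swap tr x≢y = ⇔-trans Oriented-swap (⇔-trans (tr (x≢y ∘ sym)) Oriented-swap)

  Precedence : Fin t → Fin t → Bool → Bool → Set
  Precedence q q' u v = ∀ {i i'} → i < r → i' < r → idx q i < idx q' i' ⇔ Oriented _<_ u v (cp q i) (cp q' i')

  Aligned : Bool → Fin t → Fin t → Set
  Aligned d q q' = ∀ {i i'} → i < r → i' < r → idx q i < idx q' i' → orient d (cp q i) ℤ.< orient d (cp q' i')

  precedence-directed : ∀ {q q' u v} → q ≢ q' → Precedence q q' u v → v ≡ not u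
  precedence-directed {q} {q'} {u} {v} q≢q' precedes = ¬-not λ v≡u →
    ℕ.<-asym (idx-monoˡ q' q 0<1)
             (from (precedes 1<r 0<r) (swap-copies v≡u (to (precedes 0<r 1<r) (idx-monoˡ q q' 0<1))))
    where
    -- With v ≡ u the realisation cannot tell the pair of copies (q,0),(q',1) from (q,1),(q',0), although
    -- q comes first in one of them and q' in the other.
    swap-copies : v ≡ u → Oriented _<_ u v (cp q 0) (cp q' 1) → Oriented _<_ u v (cp q 1) (cp q' 0)
    swap-copies refl = from (Oriented-symmetric (cp-≶ 1<r 0<r (distinct q≢q')))
                     ∘ to (Oriented-symmetric (cp-≶ 0<r 1<r (distinct q≢q')))

  precedence-aligned : ∀ {q q' u} → q ≢ q' → Precedence q q' u (not u) → Aligned u q q' × Aligned u q' q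
  precedence-aligned {q} {q'} {u} q≢q' precedes =
    (λ ir ir' lt → from (orient-< u) (to (precedes ir ir') lt)) ,
    (λ ir ir' lt → [ (λ wrong → contradiction (from (precedes ir' ir) (to (orient-< u) wrong)) (ℕ.<-asym lt))
                   , id
                   ]′ (≢⇒≶ ℤ.<-cmp (cp-≢ ir' ir (distinct q≢q') ∘ orient-injective u)))

  forward-pair : ∀ {q q'} → q ≢ q' → Dq q q' ≡ true → Dq q' q ≡ false →
                 Σ Bool λ d → Aligned d q q' × Aligned d q' q × Transfers d q q'
  forward-pair {q} {q'} q≢q' q→q' q'↛q = D' (B q) (B q') , proj₁ aligned , proj₂ aligned , transfers
    where
    precedes : Precedence q q' (D' (B q) (B q')) (D' (B q') (B q))
    precedes ir ir' = ⇔-trans (⇔-sym Oriented-true-false)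
                              (subst₂ (λ u v → Oriented _<_ u v _ _ ⇔ _) q→q' q'↛q (transfer ir ir' (distinct q≢q')))
    directed : D' (B q') (B q) ≡ not (D' (B q) (B q'))
    directed = precedence-directed q≢q' precedes
    aligned : Aligned (D' (B q) (B q')) q q' × Aligned (D' (B q) (B q')) q' q
    aligned = precedence-aligned q≢q' (subst (Precedence q q' _) directed precedes)
    transfers : Transfers (D' (B q) (B q')) q q'
    transfers _ rewrite q→q' | q'↛q | directed = ⇔-trans Oriented-true-false (⇔-sym (orient-forward _))

  OneWay : Fin t → Fin t → Bool
  OneWay q q' = Dq q q' xor Dq q' q

  OneWay-sym : ∀ {q q'} → T (OneWay q q') → T (OneWay q' q)
  OneWay-sym {q} {q'} e with Dq q q' | Dq q' q
  ... | true  | false = e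
  ... | false | true  = e

  OneWay-≢ : ∀ {q q'} → T (OneWay q q') → q ≢ q'
  OneWay-≢ {q} e refl = subst T (xor-same (Dq q q)) e

  ¬OneWay⇒symmetric : ∀ {q q'} → ¬ T (OneWay q q') → Dq q' q ≡ Dq q q'
  ¬OneWay⇒symmetric {q} {q'} ¬e with Dq q q' | Dq q' q
  ... | true  | true  = refl
  ... | false | false = refl
  ... | true  | false = contradiction _ ¬e
  ... | false | true  = contradiction _ ¬e

  one-way-pair : ∀ {q q'} → T (OneWay q q') → Σ Bool λ d → Aligned d q q' × Aligned d q' q × Transfers d q q'
  one-way-pair {q} {q'} e with xor-cases (Dq q q') (Dq q' q) e
  ... | inj₁ (u , v) = forward-pair (OneWay-≢ e) u v
  ... | inj₂ (u , v) = let (d , aligned , aligned' , transfers) = forward-pair (OneWay-≢ e ∘ sym) v u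
                       in d , aligned' , aligned , transfers-swap {d} transfers

  dir : Fin t → Bool
  dir q = does (cp q 0 ℕ.<? cp q 1)

  aligned-dir : ∀ {d q q'} → q ≢ q' → Aligned d q q' → Aligned d q' q → dir q ≡ d
  aligned-dir {d} {q} {q'} q≢q' aligned aligned' with Fin.<-cmp q q'
  ... | tri< q<q' _ _ = orient-<? d (ℤ.<-trans (aligned 0<r 0<r (idx-monoʳ 0 q<q'))
                                               (aligned' 0<r 1<r (idx-monoˡ q' q 0<1)))
  ... | tri≈ _ q≡q' _ = contradiction q≡q' q≢q'
  ... | tri> _ _ q'<q = orient-<? d (ℤ.<-trans (aligned 0<r 1<r (idx-monoˡ q q' 0<1))
                                               (aligned' 1<r 1<r (idx-monoʳ 1 q'<q)))

  symmetric-copies : ∀ {q q' i i'} → q ≢ q' → Dq q' q ≡ Dq q q' → i < r → i' < r →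
    T (Dq q q') ⇔ Oriented _<_ (D' (B q) (B q')) (D' (B q') (B q)) (cp q i) (cp q' i')
  symmetric-copies {q} {q'} {i} {i'} q≢q' Dq-sym ir ir' =
    ⇔-trans (⇔-sym (Oriented-symmetric (idx-≶ {q} {q'} {i} {i'} (distinct q≢q'))))
            (subst (λ v → Oriented _<_ (Dq q q') v _ _ ⇔ _) Dq-sym (transfer ir ir' (distinct q≢q')))

  Separated : Fin t → Fin t → Bool → Set
  Separated q q' u = ∀ {i i'} → i < r → i' < r → T (Dq q q') ⇔ Oriented _<_ u (not u) (cp q i) (cp q' i')

  symmetric-pair : ∀ {q q'} → q ≢ q' → Dq q' q ≡ Dq q q' →
      (D' (B q') (B q) ≡ D' (B q) (B q') × (T (Dq q q') ⇔ T (D' (B q) (B q'))))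
    ⊎ (D' (B q') (B q) ≡ not (D' (B q) (B q')) × Separated q q' (D' (B q) (B q')))
  symmetric-pair {q} {q'} q≢q' Dq-sym with D' (B q') (B q) Bool.≟ D' (B q) (B q')
  ... | yes D'-sym = inj₁ (D'-sym , ⇔-trans (symmetric-copies q≢q' Dq-sym 0<r 0<r) D'-constant)
    where
    D'-constant : Oriented _<_ (D' (B q) (B q')) (D' (B q') (B q)) (cp q 0) (cp q' 0) ⇔ T (D' (B q) (B q'))
    D'-constant = subst (λ v → Oriented _<_ (D' (B q) (B q')) v (cp q 0) (cp q' 0) ⇔ T (D' (B q) (B q'))) (sym D'-sym)
                        (Oriented-symmetric (cp-≶ 0<r 0<r (distinct q≢q')))
  ... | no D'-asym = inj₂ (¬-not D'-asym , λ {i} {i'} ir ir' →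
    subst (λ v → T (Dq q q') ⇔ Oriented _<_ (D' (B q) (B q')) v (cp q i) (cp q' i'))
          (¬-not D'-asym) (symmetric-copies q≢q' Dq-sym ir ir'))

  module Letters = Components OneWay OneWay-sym
  open Letters using (Walk; []; _▸_)
  open Letters.Representative K t≤1+K using (rep-edge; rep-walk)
  open Letters.Representative K t≤1+K public using (rep)

  -- Each step along a one-way pair widens the window of copies by one on each side, so a window around
  -- copy K survives walks of length at most K as long as r > K + K.
  walk-window : ∀ {q₀ q k} → Walk q₀ q k → ∀ a → a + k ≡ K →
    dir q ≡ dir q₀ ×
    orient (dir q₀) (cp q a) ℤ.≤ orient (dir q₀) (cp q₀ K) ×
    orient (dir q₀) (cp q₀ K) ℤ.≤ orient (dir q₀) (cp q (K + k))
  walk-window [] a a+0≡K with trans (sym (ℕ.+-identityʳ a)) a+0≡K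
  ... | refl rewrite ℕ.+-identityʳ a = refl , ℤ.≤-refl , ℤ.≤-refl
  walk-window {q₀} (_▸_ {q'} {q} {k} w e) a a+1+k≡K
    with walk-window w (suc a) (trans (sym (ℕ.+-suc a k)) a+1+k≡K) | one-way-pair e
  ... | dir-q'≡d₀ , lo , hi | d , aligned-q'q , aligned-qq' , _
    with trans (sym (aligned-dir {d} {q'} {q} (OneWay-≢ e) aligned-q'q aligned-qq')) dir-q'≡d₀
  ... | refl =
    aligned-dir {d} {q} {q'} (OneWay-≢ e ∘ sym) aligned-qq' aligned-q'q ,
    ℤ.<⇒≤ (ℤ.<-≤-trans (aligned-qq' a<r 1+a<r (idx-monoˡ q q' (ℕ.n<1+n a))) lo) ,
    ℤ.≤-trans hi (ℤ.<⇒≤ (subst (λ i → orient d (cp q' (K + k)) ℤ.< orient d (cp q i)) (sym (ℕ.+-suc K k))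
                                (aligned-q'q K+k<r 1+K+k<r (idx-monoˡ q' q (ℕ.n<1+n (K + k))))))
    where
    1+a<r : suc a < r
    1+a<r = ℕ.≤-<-trans (ℕ.≤-trans (ℕ.m≤m+n (suc a) k) (ℕ.≤-reflexive (trans (sym (ℕ.+-suc a k)) a+1+k≡K)))
                        K<r
    a<r : a < r
    a<r = ℕ.<-trans (ℕ.n<1+n a) 1+a<r
    1+k≤K : suc k ≤ K
    1+k≤K = ℕ.≤-trans (ℕ.m≤n+m (suc k) a) (ℕ.≤-reflexive a+1+k≡K)
    1+K+k<r : suc (K + k) < r
    1+K+k<r = subst (_< r) (ℕ.+-suc K k) (ℕ.≤-<-trans (ℕ.+-monoʳ-≤ K 1+k≤K) K+K<r)
    K+k<r : K + k < r
    K+k<r = ℕ.<-trans (ℕ.n<1+n (K + k)) 1+K+k<r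

  anchor : Fin t → ℕ
  anchor q = cp (rep q) K

  anchor-window : ∀ q → ∃₂ λ a b → a < r × b < r × dir q ≡ dir (rep q) ×
    orient (dir (rep q)) (cp q a) ℤ.≤ orient (dir (rep q)) (anchor q) ×
    orient (dir (rep q)) (anchor q) ℤ.≤ orient (dir (rep q)) (cp q b)
  anchor-window q with rep-walk q
  ... | k , k≤K , w =
    K ∸ k , K + k , ℕ.≤-<-trans (ℕ.m∸n≤m K k) K<r , ℕ.≤-<-trans (ℕ.+-monoʳ-≤ K k≤K) K+K<r ,
    walk-window w (K ∸ k) (ℕ.m∸n+n≡m k≤K)

  dir-rep : ∀ q → dir q ≡ dir (rep q)
  dir-rep q = proj₁ (proj₂ (proj₂ (proj₂ (proj₂ (anchor-window q)))))

  anchor-span : ∀ q → ∃₂ λ lo hi → lo < r × hi < r × cp q lo ≤ anchor q × anchor q ≤ cp q hi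
  anchor-span q with anchor-window q
  ... | a , b , a<r , b<r , _ , lo , hi with orient-between (dir (rep q)) lo hi
  ...   | inj₁ (a≤ , ≤b) = a , b , a<r , b<r , a≤ , ≤b
  ...   | inj₂ (b≤ , ≤a) = b , a , b<r , a<r , b≤ , ≤a

  anchor-like-copies : ∀ {V : Set} {u v z q} → z ≢ anchor q →
    (∀ {i} → i < r → V ⇔ Oriented _<_ u v z (cp q i)) → V ⇔ Oriented _<_ u v z (anchor q)
  anchor-like-copies {q = q} z≢anchor sees with anchor-span q
  ... | lo , hi , lo<r , hi<r , lo≤ , ≤hi =
    ⇔-trans (sees hi<r) (⇔-sym (Oriented-between lo≤ ≤hi z≢anchor (⇔-trans (⇔-sym (sees lo<r)) (sees hi<r))))

  anchor-dir : ∀ {q q'} → anchor q ≡ anchor q' → dir q ≡ dir q'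
  anchor-dir {q} {q'} same =
    trans (dir-rep q) (trans (cong (dir ∘ proj₁) (cp-injective K<r K<r same)) (sym (dir-rep q')))

  anchor-edge : ∀ {q q'} → T (OneWay q q') → anchor q ≡ anchor q'
  anchor-edge e = cong (λ q₀ → cp q₀ K) (rep-edge e)

  anchor-precedes : ∀ {q q' u} → (∀ {i i'} → i < r → i' < r → Oriented _<_ u (not u) (cp q i) (cp q' i')) →
                    Oriented _<_ u (not u) (anchor q) (anchor q')
  anchor-precedes {q} {q'} {u} precedes with anchor-span q | anchor-span q'
  ... | lo , hi , lo<r , hi<r , lo≤ , ≤hi | lo' , hi' , lo'<r , hi'<r , lo'≤ , ≤hi'
    with u | precedes hi<r lo'<r | precedes lo<r hi'<r
  ...   | true  | forward _ hi<lo' | _ = forward _ (ℕ.≤-<-trans ≤hi (ℕ.<-≤-trans hi<lo' lo'≤))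
  ...   | false | _ | backward _ hi'<lo = backward _ (ℕ.≤-<-trans ≤hi' (ℕ.<-≤-trans hi'<lo lo≤))

  separated-anchors : ∀ {q q' u} → q ≢ q' → Separated q q' u →
    (T (Dq q q') ⇔ Oriented _<_ u (not u) (anchor q) (anchor q')) × anchor q ≢ anchor q'
  separated-anchors {q} {q'} {u} q≢q' separated with T? (Dq q q')
  ... | yes du = mk⇔ (λ _ → before) (λ _ → du) ,
                 λ same → directed-irrefl (subst (λ a → Oriented _<_ u (not u) a (anchor q')) same before)
    where
    before = anchor-precedes λ ir ir' → to (separated ir ir') du
  ... | no ¬du = mk⇔ (λ du → contradiction du ¬du) (λ before → contradiction before (directed-asym after)) ,
                 λ same → directed-irrefl (subst (λ a → Oriented _<_ u (not u) a (anchor q)) (sym same) after)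
    where
    after = anchor-precedes λ ir ir' → directed-flip (cp-≢ ir' ir (distinct q≢q')) (¬du ∘ from (separated ir' ir))

  transfers-at-common-anchor : ∀ {q q'} → anchor q ≡ anchor q' → Transfers (dir q) q q'
  transfers-at-common-anchor {q} {q'} same with q Fin.≟ q'
  ... | yes refl = transfers-symmetric {dir q} refl refl (loops-agree q)
  ... | no q≢q' with T? (OneWay q q')
  ...   | yes e = let (d , aligned , aligned' , transfers) = one-way-pair e
                  in subst (λ d → Transfers d q q') (sym (aligned-dir {d} {q} {q'} q≢q' aligned aligned'))
                           transfers
  ...   | no ¬e with symmetric-pair q≢q' (¬OneWay⇒symmetric ¬e)
  ...     | inj₁ (D'-sym , same-arcs) = transfers-symmetric {dir q} (¬OneWay⇒symmetric ¬e) D'-sym same-arcs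
  ...     | inj₂ (_ , separated) = contradiction same (proj₂ (separated-anchors q≢q' separated))

  transfers-at-distinct-anchors : ∀ {q q' x y} → anchor q ≢ anchor q' → x ≢ y →
    Oriented _<_ (Dq q q') (Dq q' q) x y ⇔ Oriented _<_ (D' (B q) (B q')) (D' (B q') (B q)) (anchor q) (anchor q')
  transfers-at-distinct-anchors {q} {q'} differ x≢y with T? (OneWay q q')
  ... | yes e = contradiction (anchor-edge e) differ
  ... | no ¬e with symmetric-pair (differ ∘ cong anchor) (¬OneWay⇒symmetric ¬e)
  ...   | inj₁ (D'-sym , same-arcs) rewrite ¬OneWay⇒symmetric ¬e | D'-sym =
    ⇔-trans (Oriented-symmetric (≢⇒≶ ℕ.<-cmp x≢y))
            (⇔-trans same-arcs (⇔-sym (Oriented-symmetric (≢⇒≶ ℕ.<-cmp differ))))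
  ...   | inj₂ (D'-asym , separated) rewrite ¬OneWay⇒symmetric ¬e | D'-asym =
    ⇔-trans (Oriented-symmetric (≢⇒≶ ℕ.<-cmp x≢y)) (proj₁ (separated-anchors (differ ∘ cong anchor) separated))

  key : Fin t → ℕ → ℕ × ℤ
  key q x = anchor q , orient (dir q) x

  key-< : ∀ {q q' x y} → anchor q ≡ anchor q' → key q x <ₖ key q' y ⇔ orient (dir q) x ℤ.< orient (dir q) y
  key-< {q} {q'} {x} {y} same =
    subst (λ d → key q x <ₖ (anchor q' , orient d y) ⇔ orient (dir q) x ℤ.< orient (dir q) y)
          (anchor-dir same) (<ₖ-second same)

  key-transfer : ∀ {q q' x y} → x ≢ y →
    Oriented _<_ (Dq q q') (Dq q' q) x y ⇔ Oriented _<ₖ_ (D' (B q) (B q')) (D' (B q') (B q)) (key q x) (key q' y)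
  key-transfer {q} {q'} {x} {y} x≢y with anchor q ℕ.≟ anchor q'
  ... | yes same = ⇔-trans (transfers-at-common-anchor same x≢y) (Oriented-cong (⇔-sym (key-< same)) (⇔-sym key-<′))
    where
    key-<′ : key q' y <ₖ key q x ⇔ orient (dir q) y ℤ.< orient (dir q) x
    key-<′ = subst (λ d → key q' y <ₖ key q x ⇔ orient d y ℤ.< orient d x)
                   (sym (anchor-dir same)) (key-< (sym same))
  ... | no differ = ⇔-trans (transfers-at-distinct-anchors differ x≢y)
                            (Oriented-cong (⇔-sym (<ₖ-first differ)) (⇔-sym (<ₖ-first (differ ∘ sym))))

  key-injective : ∀ {q q' x y} → key q x ≡ key q' y → x ≡ y
  key-injective {q} {q'} {x} {y} eq =
    orient-injective (dir q) (trans (cong proj₂ eq) (cong (λ d → orient d y) (sym (anchor-dir (cong proj₁ eq)))))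

-- Reading the blue subword

lookupOr : X → List X → ℕ → X
lookupOr d []       _       = d
lookupOr d (x ∷ xs) zero    = x
lookupOr d (x ∷ xs) (suc k) = lookupOr d xs k

lookupOr-map : ∀ (f : X → Y) (d : X) xs k → lookupOr (f d) (map f xs) k ≡ f (lookupOr d xs k)
lookupOr-map f d []       k       = refl
lookupOr-map f d (x ∷ xs) zero    = refl
lookupOr-map f d (x ∷ xs) (suc k) = lookupOr-map f d xs k

lookupOr-cases : ∀ (d : X) xs k → lookupOr d xs k ≡ d ⊎ k < length xs
lookupOr-cases d []       k       = inj₁ refl
lookupOr-cases d (x ∷ xs) zero    = inj₂ (s≤s z≤n)
lookupOr-cases d (x ∷ xs) (suc k) = Sum.map₂ s≤s (lookupOr-cases d xs k)

lookupOr-++ˡ : ∀ (d : X) xs ys {k} → k < length xs → lookupOr d (xs ++ ys) k ≡ lookupOr d xs k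
lookupOr-++ˡ d (x ∷ xs) ys {zero}  _         = refl
lookupOr-++ˡ d (x ∷ xs) ys {suc k} (s≤s k<) = lookupOr-++ˡ d xs ys k<

lookupOr-++ʳ : ∀ (d : X) xs ys k → lookupOr d (xs ++ ys) (length xs + k) ≡ lookupOr d ys k
lookupOr-++ʳ d []       ys k = refl
lookupOr-++ʳ d (x ∷ xs) ys k = lookupOr-++ʳ d xs ys k

lookupOr-concat-replicate : ∀ (d : X) xs {r i k} → i < r → k < length xs →
                            lookupOr d (concat (replicate r xs)) (i * length xs + k) ≡ lookupOr d xs k
lookupOr-concat-replicate d xs {suc r} {zero}  _         k< = lookupOr-++ˡ d xs _ k<
lookupOr-concat-replicate d xs {suc r} {suc i} {k} (s≤s i<r) k< = begin
  lookupOr d (xs ++ rest) (length xs + i * length xs + k)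
    ≡⟨ cong (lookupOr d (xs ++ rest)) (ℕ.+-assoc (length xs) (i * length xs) k) ⟩
  lookupOr d (xs ++ rest) (length xs + (i * length xs + k)) ≡⟨ lookupOr-++ʳ d xs rest (i * length xs + k) ⟩
  lookupOr d rest (i * length xs + k)                       ≡⟨ lookupOr-concat-replicate d xs i<r k< ⟩
  lookupOr d xs k                                           ∎
  where
  open ≡-Reasoning
  rest = concat (replicate r xs)

lookupOr-tabulate : ∀ (d : X) {t} (s : Fin t → X) q → lookupOr d (tabulate s) (toℕ q) ≡ s q
lookupOr-tabulate d s Fin.zero    = refl
lookupOr-tabulate d s (Fin.suc q) = lookupOr-tabulate d (s ∘ Fin.suc) q

lookupOr-power : ∀ (d : X) {t r} (s : Fin t → X) q {i} → i < r →
                 lookupOr d (concat (replicate r (tabulate s))) (idx q i) ≡ s q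
lookupOr-power d {t} {r} s q {i} i<r = begin
  lookupOr d power (i * t + toℕ q)
    ≡⟨ cong (λ l → lookupOr d power (i * l + toℕ q)) (sym (length-tabulate s)) ⟩
  lookupOr d power (i * length (tabulate s) + toℕ q) ≡⟨ lookupOr-concat-replicate d (tabulate s) i<r q<length ⟩
  lookupOr d (tabulate s) (toℕ q)                    ≡⟨ lookupOr-tabulate d s q ⟩
  s q                                                ∎
  where
  open ≡-Reasoning
  power = concat (replicate r (tabulate s))
  q<length = subst (toℕ q <_) (sym (length-tabulate s)) (Fin.toℕ<n q)

length-concat-replicate : ∀ (xs : List X) r → length (concat (replicate r xs)) ≡ r * length xs
length-concat-replicate xs zero    = refl
length-concat-replicate xs (suc r) =
  trans (length-++ xs) (cong (λ l → length xs + l) (length-concat-replicate xs r))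

read-map : ∀ {n} (J : Subset n) (f : Fin n → X) (h : X → Y) → read J (h ∘ f) ≡ map h (read J f)
read-map {n = zero}  []          f h = refl
read-map {n = suc n} (true ∷ J)  f h = cong (h (f Fin.zero) ∷_) (read-map J (f ∘ Fin.suc) h)
read-map {n = suc n} (false ∷ J) f h = read-map J (f ∘ Fin.suc) h

read-∈ : ∀ {n} (J : Subset n) (f : Fin n → X) d {k} → k < length (read J f) →
         ∃ λ i → i ∈ J × lookupOr d (read J f) k ≡ f i
read-∈ (true ∷ J)  f d {zero}  _ = Fin.zero , here , refl
read-∈ (true ∷ J)  f d {suc k} (s≤s k<) =
  let (i , i∈J , eq) = read-∈ J (f ∘ Fin.suc) d k< in Fin.suc i , there i∈J , eq
read-∈ (false ∷ J) f d k< =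
  let (i , i∈J , eq) = read-∈ J (f ∘ Fin.suc) d k< in Fin.suc i , there i∈J , eq

read-increasing : ∀ {n N} (J : Subset n) {f : Fin n → Fin N} → (∀ {i i'} → i Fin.< i' → f i Fin.< f i') →
  ∀ d {k k'} → k < k' → k' < length (read J f) → lookupOr d (read J f) k Fin.< lookupOr d (read J f) k'
read-increasing (true ∷ J) {f} mono d {zero} {suc k'} _ (s≤s k'<) with read-∈ J (f ∘ Fin.suc) d k'<
... | i , _ , eq rewrite eq = mono (s≤s z≤n)
read-increasing (true ∷ J) mono d {suc k} {suc k'} (s≤s k<k') (s≤s k'<) =
  read-increasing J (mono ∘ s≤s) d k<k' k'<
read-increasing (false ∷ J) mono d k<k' k'< = read-increasing J (mono ∘ s≤s) d k<k' k'<

-- The realisation of G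

double≤2^ : ∀ K → K + K ≤ 2 ^ K
double≤2^ 0 = z≤n
double≤2^ 1 = ℕ.≤-refl
double≤2^ (suc (suc K)) = begin
  suc (suc K) + suc (suc K) ≡⟨ cong suc (ℕ.+-suc (suc K) (suc K)) ⟩
  2 + (suc K + suc K)       ≤⟨ ℕ.+-mono-≤ (ℕ.*-monoʳ-≤ 2 (ℕ.m^n>0 2 K)) (double≤2^ (suc K)) ⟩
  2 ^ suc K + 2 ^ suc K     ≡⟨ cong (λ x → 2 ^ suc K + x) (sym (ℕ.+-identityʳ (2 ^ suc K))) ⟩
  2 ^ suc (suc K)           ∎
  where open ℕ.≤-Reasoning

module Construction {k m n : ℕ} (D : Decoder k) (D' : Decoder m) (G : Graph n)
  (ℓ : Fin n → Fin k) (c : Fin n ↔ Fin n) (realisation : IsLetterRealisation (Graph.Adj G) D ℓ c)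
  (j p : ℕ) (j+p<n : j + p < n) (t : ℕ) (s : Fin t → Fin k)
  (factor-letters : ∀ i → T (inI j p i) → ∃ λ q → word ℓ c i ≡ s q)
  (J : Subset n) (J⊆I : ∀ i → i ∈ J → T (inI j p i))
  (reading : read J (word ℓ c) ≡ concat (replicate (2 ^ (t ∸ 1) + 1) (tabulate s)))
  (m' : ℕ) (ℓ' : VDel c j p J → Fin m) (c' : VDel c j p J ↔ Fin m')
  (realisation' : IsLetterRealisation (AdjDel G c j p J) D' ℓ' c')
  (blue-letters : ∀ (x y : VDel c j p J) → T (isBlue c J (proj₁ x)) → T (isBlue c J (proj₁ y)) →
                  ℓ (proj₁ x) ≡ ℓ (proj₁ y) → ℓ' x ≡ ℓ' y)
  where

  open Graph G using (Adj) renaming (sym to Adj-sym)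

  pos : Fin n → ℕ
  pos x = toℕ (Inverse.to c x)

  pos' : VDel c j p J → ℕ
  pos' x = toℕ (Inverse.to c' x)

  InFactor : Fin n → Set
  InFactor x = T (inI j p (Inverse.to c x))

  K r : ℕ
  K = t ∸ 1
  r = 2 ^ K + 1

  t≤1+K : t ≤ suc K
  t≤1+K = ℕ.m≤n+m∸n t 1

  K+K<r : K + K < r
  K+K<r = ℕ.≤-<-trans (double≤2^ K) (ℕ.m<m+n (2 ^ K) (s≤s z≤n))

  1<r : 1 < r
  1<r = ℕ.+-monoˡ-< 1 (ℕ.m^n>0 2 K)

  0<r : 0 < r
  0<r = ℕ.<-trans (s≤s z≤n) 1<r

  G-adjacency : ∀ {x y} → x ≢ y → Adj x y ⇔ Oriented _<_ (D (ℓ x) (ℓ y)) (D (ℓ y) (ℓ x)) (pos x) (pos y)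
  G-adjacency = realisation-adjacency {D = D} {ℓ} {c} realisation

  G'-adjacency : ∀ {x y} → x ≢ y →
                 Adj (proj₁ x) (proj₁ y) ⇔ Oriented _<_ (D' (ℓ' x) (ℓ' y)) (D' (ℓ' y) (ℓ' x)) (pos' x) (pos' y)
  G'-adjacency = realisation-adjacency {D = D'} {ℓ'} {c'} realisation'

  ∈J⇒not-red : ∀ {x} → Inverse.to c x ∈ J → T (not (isRed c j p J x))
  ∈J⇒not-red {x} x∈J rewrite []=⇒lookup x∈J | ∧-zeroʳ (inI j p (Inverse.to c x)) = tt

  ∉I⇒not-red : ∀ {x} → ¬ InFactor x → T (not (isRed c j p J x))
  ∉I⇒not-red {x} x∉I with inI j p (Inverse.to c x)
  ... | true  = ⊥-elim (x∉I tt)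
  ... | false = tt

  positions : List (Fin n)
  positions = read J id

  word-positions : map (word ℓ c) positions ≡ concat (replicate r (tabulate s))
  word-positions = trans (sym (read-map J id (word ℓ c))) reading

  length-positions : length positions ≡ r * t
  length-positions = begin
    length positions                          ≡⟨ sym (length-map (word ℓ c) positions) ⟩
    length (map (word ℓ c) positions)         ≡⟨ cong length word-positions ⟩
    length (concat (replicate r (tabulate s))) ≡⟨ length-concat-replicate (tabulate s) r ⟩
    r * length (tabulate s)                   ≡⟨ cong (λ l → r * l) (length-tabulate s) ⟩
    r * t                                     ∎
    where open ≡-Reasoning

  idx<length : ∀ q {i} → i < r → idx q i < length positions
  idx<length q {i} i<r = subst (idx q i <_) (sym length-positions) (idx-< q i<r)

  origin : Fin n
  origin = fromℕ< (ℕ.≤-<-trans (ℕ.m≤m+n j p) j+p<n)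

  -- Used as the default of lookupOr, so that blue q i lies in J even when i is out of range.
  first : Fin n
  first = lookupOr origin positions 0

  first-∈J : Fin t → first ∈ J
  first-∈J q = let (x , x∈J , eq) = read-∈ J id origin {0} (ℕ.≤-<-trans z≤n (idx<length q 0<r))
               in subst (_∈ J) (sym eq) x∈J

  blue : Fin t → ℕ → Fin n
  blue q i = Inverse.from c (lookupOr first positions (idx q i))

  to-blue : ∀ q i → Inverse.to c (blue q i) ≡ lookupOr first positions (idx q i)
  to-blue q i = Inverse.strictlyInverseˡ c _

  blue-∈J : ∀ q i → Inverse.to c (blue q i) ∈ J
  blue-∈J q i with lookupOr-cases first positions (idx q i)
  ... | inj₁ eq = subst (_∈ J) (sym (trans (to-blue q i) eq)) (first-∈J q)
  ... | inj₂ k< = let (x , x∈J , eq) = read-∈ J id first k<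
                  in subst (_∈ J) (sym (trans (to-blue q i) eq)) x∈J

  blue-letter : ∀ q {i} → i < r → ℓ (blue q i) ≡ s q
  blue-letter q {i} i<r = begin
    word ℓ c (lookupOr first positions (idx q i))
      ≡⟨ sym (lookupOr-map (word ℓ c) first positions (idx q i)) ⟩
    lookupOr (word ℓ c first) (map (word ℓ c) positions) (idx q i)
      ≡⟨ cong (λ ws → lookupOr (word ℓ c first) ws (idx q i)) word-positions ⟩
    lookupOr (word ℓ c first) (concat (replicate r (tabulate s))) (idx q i)
      ≡⟨ lookupOr-power (word ℓ c first) s q i<r ⟩
    s q ∎
    where open ≡-Reasoning

  blue-mono : ∀ {q q' i i'} → i' < r → idx q i < idx q' i' → pos (blue q i) < pos (blue q' i')
  blue-mono {q} {q'} {i} {i'} i'<r lt = subst₂ (λ a b → toℕ a < toℕ b) (sym (to-blue q i)) (sym (to-blue q' i'))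
                                               (read-increasing J id first lt (idx<length q' i'<r))

  blue-< : ∀ {q q' i i'} → i < r → i' < r → pos (blue q i) < pos (blue q' i') ⇔ idx q i < idx q' i'
  blue-< {q} {q'} {i} {i'} i<r i'<r = mk⇔ reflects (blue-mono {q} {q'} {i} {i'} i'<r)
    where
    reflects : pos (blue q i) < pos (blue q' i') → idx q i < idx q' i'
    reflects lt with ℕ.<-cmp (idx q i) (idx q' i')
    ... | tri< before _ _ = before
    ... | tri≈ _ same _ with idx-injective {q = q} {q'} {i} {i'} same
    ...   | refl = contradiction lt (ℕ.<-irrefl refl)
    reflects lt | tri> _ _ after = contradiction lt (ℕ.<-asym (blue-mono {q'} {q} {i'} {i} i<r after))

  blue-injective : ∀ {q q' i i'} → i < r → i' < r → blue q i ≡ blue q' i' → (q , i) ≡ (q' , i')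
  blue-injective {q} {q'} {i} {i'} i<r i'<r eq with ℕ.<-cmp (idx q i) (idx q' i')
  ... | tri< before _ _ = contradiction (cong pos eq) (ℕ.<⇒≢ (blue-mono {q} {q'} {i} {i'} i'<r before))
  ... | tri≈ _ same _ = idx-injective same
  ... | tri> _ _ after = contradiction (cong pos eq) (ℕ.>⇒≢ (blue-mono {q'} {q} {i'} {i} i<r after))

  blueV : Fin t → ℕ → VDel c j p J
  blueV q i = blue q i , ∈J⇒not-red (blue-∈J q i)

  ∈J⇒blue : ∀ {x} → Inverse.to c x ∈ J → T (isBlue c J x)
  ∈J⇒blue x∈J = subst T (sym ([]=⇒lookup x∈J)) tt

  B : Fin t → Fin m
  B q = ℓ' (blueV q 0)

  blue-label : ∀ q {i} → i < r → ℓ' (blueV q i) ≡ B q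
  blue-label q {i} i<r = blue-letters (blueV q i) (blueV q 0) (∈J⇒blue (blue-∈J q i)) (∈J⇒blue (blue-∈J q 0))
                                      (trans (blue-letter q i<r) (sym (blue-letter q 0<r)))

  cp : Fin t → ℕ → ℕ
  cp q i = pos' (blueV q i)

  c'-injective : ∀ {x y} → Inverse.to c' x ≡ Inverse.to c' y → x ≡ y
  c'-injective = Injection.injective (↔⇒↣ c')

  cp-injective : ∀ {q q' i i'} → i < r → i' < r → cp q i ≡ cp q' i' → (q , i) ≡ (q' , i')
  cp-injective i<r i'<r eq = blue-injective i<r i'<r (cong proj₁ (c'-injective (Fin.toℕ-injective eq)))

  transfer : ∀ {q q' i i'} → i < r → i' < r → (q , i) ≢ (q' , i') →
    Oriented _<_ (D (s q) (s q')) (D (s q') (s q)) (idx q i) (idx q' i') ⇔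
    Oriented _<_ (D' (B q) (B q')) (D' (B q') (B q)) (cp q i) (cp q' i')
  transfer {q} {q'} {i} {i'} i<r i'<r ne = begin
    Oriented _<_ (D (s q) (s q')) (D (s q') (s q)) (idx q i) (idx q' i')
      ∼⟨ Oriented-cong (⇔-sym (blue-< i<r i'<r)) (⇔-sym (blue-< i'<r i<r)) ⟩
    Oriented _<_ (D (s q) (s q')) (D (s q') (s q)) (pos x) (pos y)
      ≡⟨ cong₂ (λ a b → Oriented _<_ (D a b) (D b a) (pos x) (pos y))
               (sym (blue-letter q i<r)) (sym (blue-letter q' i'<r)) ⟩
    Oriented _<_ (D (ℓ x) (ℓ y)) (D (ℓ y) (ℓ x)) (pos x) (pos y)
      ∼⟨ ⇔-sym (G-adjacency x≢y) ⟩
    Adj x y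
      ∼⟨ G'-adjacency (x≢y ∘ cong proj₁) ⟩
    Oriented _<_ (D' (ℓ' (blueV q i)) (ℓ' (blueV q' i'))) (D' (ℓ' (blueV q' i')) (ℓ' (blueV q i))) (cp q i) (cp q' i')
      ≡⟨ cong₂ (λ a b → Oriented _<_ (D' a b) (D' b a) (cp q i) (cp q' i'))
               (blue-label q i<r) (blue-label q' i'<r) ⟩
    Oriented _<_ (D' (B q) (B q')) (D' (B q') (B q)) (cp q i) (cp q' i') ∎
    where
    open EquationalReasoning
    x = blue q i
    y = blue q' i'
    x≢y : x ≢ y
    x≢y = ne ∘ blue-injective i<r i'<r

  open Copies K r t≤1+K K+K<r 1<r (λ q q' → D (s q) (s q')) D' B cp cp-injective transfer
    using (rep; anchor; anchor-like-copies; key; key-transfer; key-injective)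

  in-factor-bounds : ∀ {i : Fin n} → T (inI j p i) → j ≤ toℕ i × toℕ i ≤ j + p
  in-factor-bounds {i} i∈I with to T-∧ i∈I
  ... | j≤i , i≤j+p = ℕ.≤ᵇ⇒≤ j (toℕ i) j≤i , ℕ.≤ᵇ⇒≤ (toℕ i) (j + p) i≤j+p

  outside-factor-bounds : ∀ {i : Fin n} → ¬ T (inI j p i) → toℕ i < j ⊎ j + p < toℕ i
  outside-factor-bounds {i} i∉I with j ℕ.≤? toℕ i | toℕ i ℕ.≤? j + p
  ... | no j≰i   | _          = inj₁ (ℕ.≰⇒> j≰i)
  ... | yes _    | no i≰j+p   = inj₂ (ℕ.≰⇒> i≰j+p)
  ... | yes j≤i  | yes i≤j+p  = contradiction (from T-∧ (ℕ.≤⇒≤ᵇ j≤i , ℕ.≤⇒≤ᵇ i≤j+p)) i∉I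

  same-side : ∀ {z x y} → ¬ InFactor z → InFactor x → InFactor y →
              (pos z < pos x ⇔ pos z < pos y) × (pos x < pos z ⇔ pos y < pos z)
  same-side z∉I x∈I y∈I with outside-factor-bounds z∉I | in-factor-bounds x∈I | in-factor-bounds y∈I
  ... | inj₁ z<j | j≤x , _ | j≤y , _ =
    ⇔-both z<x z<y , ⇔-neither (ℕ.<-asym z<x) (ℕ.<-asym z<y)
    where
    z<x = ℕ.<-≤-trans z<j j≤x
    z<y = ℕ.<-≤-trans z<j j≤y
  ... | inj₂ j+p<z | _ , x≤j+p | _ , y≤j+p =
    ⇔-neither (ℕ.<-asym x<z) (ℕ.<-asym y<z) , ⇔-both x<z y<z
    where
    x<z = ℕ.≤-<-trans x≤j+p j+p<z
    y<z = ℕ.≤-<-trans y≤j+p j+p<z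

  seen-alike-from-outside : ∀ {z x y} → ¬ InFactor z → InFactor x → InFactor y → ℓ x ≡ ℓ y → Adj z x ⇔ Adj z y
  seen-alike-from-outside {z} {x} {y} z∉I x∈I y∈I ℓx≡ℓy = begin
    Adj z x
      ∼⟨ G-adjacency z≢x ⟩
    Oriented _<_ (D (ℓ z) (ℓ x)) (D (ℓ x) (ℓ z)) (pos z) (pos x)
      ∼⟨ Oriented-cong (proj₁ sides) (proj₂ sides) ⟩
    Oriented _<_ (D (ℓ z) (ℓ x)) (D (ℓ x) (ℓ z)) (pos z) (pos y)
      ≡⟨ cong (λ a → Oriented _<_ (D (ℓ z) a) (D a (ℓ z)) (pos z) (pos y)) ℓx≡ℓy ⟩
    Oriented _<_ (D (ℓ z) (ℓ y)) (D (ℓ y) (ℓ z)) (pos z) (pos y)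
      ∼⟨ ⇔-sym (G-adjacency z≢y) ⟩
    Adj z y ∎
    where
    open EquationalReasoning
    sides = same-side z∉I x∈I y∈I
    z≢x : z ≢ x
    z≢x refl = z∉I x∈I
    z≢y : z ≢ y
    z≢y refl = z∉I y∈I

  data Place (x : Fin n) : Set where
    inner : (q : Fin t) → InFactor x → ℓ x ≡ s q → Place x
    outer : ¬ InFactor x → Place x

  place : ∀ x → Place x
  place x with T? (inI j p (Inverse.to c x))
  ... | yes x∈I = let (q , letter) = factor-letters _ x∈I
                  in inner q x∈I (trans (cong ℓ (sym (Inverse.strictlyInverseʳ c x))) letter)
  ... | no x∉I = outer x∉I

  outerV : ∀ {x} → ¬ InFactor x → VDel c j p J
  outerV {x} x∉I = x , ∉I⇒not-red x∉I

  outer≢blue : ∀ {z} (z∉I : ¬ InFactor z) q i → z ≢ blue q i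
  outer≢blue z∉I q i refl = z∉I (J⊆I _ (blue-∈J q i))

  outer≢anchor : ∀ {z} (z∉I : ¬ InFactor z) q → pos' (outerV z∉I) ≢ anchor q
  outer≢anchor z∉I q eq = outer≢blue z∉I (rep q) K (cong proj₁ (c'-injective (Fin.toℕ-injective eq)))

  label : ∀ {x} → Place x → Fin m
  label (inner q _ _) = B q
  label (outer x∉I)   = ℓ' (outerV x∉I)

  placeKey : ∀ {x} → Place x → ℕ × ℤ
  placeKey {x} (inner q _ _) = key q (pos x)
  placeKey     (outer x∉I)   = pos' (outerV x∉I) , + 0

  pos-injective : ∀ {x y} → pos x ≡ pos y → x ≡ y
  pos-injective = Injection.injective (↔⇒↣ c) ∘ Fin.toℕ-injective

  outer-inner : ∀ {z x q} (z∉I : ¬ InFactor z) → InFactor x → ℓ x ≡ s q →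
    Adj z x ⇔ Oriented _<ₖ_ (D' (ℓ' (outerV z∉I)) (B q)) (D' (B q) (ℓ' (outerV z∉I)))
                            (pos' (outerV z∉I) , + 0) (key q (pos x))
  outer-inner {z} {x} {q} z∉I x∈I ℓx≡sq =
    ⇔-trans (anchor-like-copies z'≢anchor towards)
            (Oriented-cong (⇔-sym (<ₖ-first z'≢anchor)) (⇔-sym (<ₖ-first (z'≢anchor ∘ sym))))
    where
    e = ℓ' (outerV z∉I)
    z' = pos' (outerV z∉I)
    z'≢anchor = outer≢anchor z∉I q
    towards : ∀ {i} → i < r → Adj z x ⇔ Oriented _<_ (D' e (B q)) (D' (B q) e) z' (cp q i)
    towards {i} i<r = begin
      Adj z x
        ∼⟨ seen-alike-from-outside z∉I x∈I (J⊆I _ (blue-∈J q i)) (trans ℓx≡sq (sym (blue-letter q i<r))) ⟩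
      Adj z (blue q i)
        ∼⟨ G'-adjacency (outer≢blue z∉I q i ∘ cong proj₁) ⟩
      Oriented _<_ (D' e (ℓ' (blueV q i))) (D' (ℓ' (blueV q i)) e) z' (cp q i)
        ≡⟨ cong (λ b → Oriented _<_ (D' e b) (D' b e) z' (cp q i)) (blue-label q i<r) ⟩
      Oriented _<_ (D' e (B q)) (D' (B q) e) z' (cp q i) ∎
      where open EquationalReasoning

  place-adjacency : ∀ {x y} → x ≢ y → (px : Place x) (py : Place y) →
    Adj x y ⇔ Oriented _<ₖ_ (D' (label px) (label py)) (D' (label py) (label px)) (placeKey px) (placeKey py)
  place-adjacency x≢y (outer x∉I) (outer y∉I) =
    ⇔-trans (G'-adjacency (x≢y ∘ cong proj₁))
            (Oriented-cong (⇔-sym (<ₖ-first x'≢y')) (⇔-sym (<ₖ-first (x'≢y' ∘ sym))))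
    where
    x'≢y' : pos' (outerV x∉I) ≢ pos' (outerV y∉I)
    x'≢y' = x≢y ∘ cong proj₁ ∘ c'-injective ∘ Fin.toℕ-injective
  place-adjacency x≢y (outer x∉I) (inner q y∈I ℓy) = outer-inner x∉I y∈I ℓy
  place-adjacency x≢y (inner q x∈I ℓx) (outer y∉I) =
    ⇔-trans (mk⇔ Adj-sym Adj-sym) (⇔-trans (outer-inner y∉I x∈I ℓx) Oriented-swap)
  place-adjacency {x} {y} x≢y (inner q x∈I ℓx) (inner q' y∈I ℓy) = begin
    Adj x y
      ∼⟨ G-adjacency x≢y ⟩
    Oriented _<_ (D (ℓ x) (ℓ y)) (D (ℓ y) (ℓ x)) (pos x) (pos y)
      ≡⟨ cong₂ (λ a b → Oriented _<_ (D a b) (D b a) (pos x) (pos y)) ℓx ℓy ⟩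
    Oriented _<_ (D (s q) (s q')) (D (s q') (s q)) (pos x) (pos y)
      ∼⟨ key-transfer (x≢y ∘ pos-injective) ⟩
    Oriented _<ₖ_ (D' (B q) (B q')) (D' (B q') (B q)) (key q (pos x)) (key q' (pos y)) ∎
    where open EquationalReasoning

  placeKey-injective : ∀ {x y} (px : Place x) (py : Place y) → placeKey px ≡ placeKey py → x ≡ y
  placeKey-injective (outer x∉I) (outer y∉I) eq = cong proj₁ (c'-injective (Fin.toℕ-injective (cong proj₁ eq)))
  placeKey-injective (outer x∉I) (inner q _ _) eq = contradiction (cong proj₁ eq) (outer≢anchor x∉I q)
  placeKey-injective (inner q _ _) (outer y∉I) eq = contradiction (sym (cong proj₁ eq)) (outer≢anchor y∉I q)
  placeKey-injective (inner q _ _) (inner q' _ _) eq = pos-injective (key-injective eq)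

  ℓ'' : Fin n → Fin m
  ℓ'' x = label (place x)

  vertexKey : Fin n → ℕ × ℤ
  vertexKey x = placeKey (place x)

  vertexKey-injective : ∀ {x y} → Pointwise _≡_ _≡_ (vertexKey x) (vertexKey y) → x ≡ y
  vertexKey-injective {x} {y} = placeKey-injective (place x) (place y) ∘ ≡×≡⇒≡

  adjacency : ∀ x y → x ≢ y →
              Adj x y ⇔ Oriented _<ₖ_ (D' (ℓ'' x) (ℓ'' y)) (D' (ℓ'' y) (ℓ'' x)) (vertexKey x) (vertexKey y)
  adjacency x y x≢y = place-adjacency x≢y (place x) (place y)

lemma4p4 : {k m n : ℕ} (D : Decoder k) (D' : Decoder m) (G : Graph n)
    (ℓ : Fin n → Fin k) (c : Fin n ↔ Fin n) →
    IsLetterRealisation (Graph.Adj G) D ℓ c →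
    (j p : ℕ) → j + p < n →
    (t : ℕ) (s : Fin t → Fin k) → Injective _≡_ _≡_ s →
    (∀ i → T (inI j p i) → ∃ λ q → word ℓ c i ≡ s q) →
    (∀ q → ∃ λ i → T (inI j p i) × word ℓ c i ≡ s q) →
    (J : Subset n) → (∀ i → i ∈ J → T (inI j p i)) →
    read J (word ℓ c) ≡ concat (replicate (2 ^ (t ∸ 1) + 1) (tabulate s)) →
    (m' : ℕ) (ℓ' : VDel c j p J → Fin m) (c' : VDel c j p J ↔ Fin m') →
    IsLetterRealisation (AdjDel G c j p J) D' ℓ' c' →
    (∀ (x y : VDel c j p J) → T (isBlue c J (proj₁ x)) → T (isBlue c J (proj₁ y)) →
      ℓ (proj₁ x) ≡ ℓ (proj₁ y) → ℓ' x ≡ ℓ' y) →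
    Σ (Fin n → Fin m) λ ℓ'' → Σ (Fin n ↔ Fin n) λ c'' →
      IsLetterRealisation (Graph.Adj G) D' ℓ'' c''
lemma4p4 D D' G ℓ c realisation j p j+p<n t s _ factor-letters _ J J⊆I reading m' ℓ' c' realisation' blue-letters =
  ℓ'' , sortBy vertexKey vertexKey-injective , realisation-by-key vertexKey vertexKey-injective {D = D'} adjacency
  where
  open Construction D D' G ℓ c realisation j p j+p<n t s factor-letters J J⊆I reading
                    m' ℓ' c' realisation' blue-letters
  open Sorting keyOrder
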